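{- For any 0-1 matrix (or family of 0-1 matrices) $P$ and all positive integers $n, m, k$, we have $ex(n, m, P) \leq k\,(lx_{k}(m, P)+n)$.
   Context: A 0-1 matrix $M$ contains a 0-1 matrix $P$ if some submatrix of $M$ (obtained by selecting some rows and some columns, keeping their order) either equals $P$ or can be turned into $P$ by changing some ones to zeroes; otherwise $M$ avoids $P$. For a family $P$ of 0-1 matrices, $M$ avoids $P$ if it avoids every member. $ex(n, m, P)$ is the maximum number of ones in a 0-1 matrix with $m$ rows and $n$ columns that avoids $P$. $lx_{k}(m, P)$ is the maximum possible number of distinct letters in a matrix with $m$ rows (and any number of columns), each entry of which is either blank or holds one letter, such that each letter occurs at least $k$ times, all occurrences of each letter lie in a single column, and the 0-1 matrix obtained by changing all letters to ones and all blanks to zeroes avoids $P$. -}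

module Defs where

open import Data.Nat using (ℕ; zero; suc; _+_; _≤_; _<_)
open import Data.Fin using (Fin) renaming (zero to fzero; suc to fsuc; _<_ to _<ᶠ_)
open import Data.Fin.Properties using (_≟_)
open import Data.Bool using (Bool; true; false; if_then_else_)
open import Data.Maybe using (Maybe; just; nothing)
open import Data.Product using (Σ; ∃; _×_; _,_)
open import Relation.Nullary using (¬_; yes; no)
open import Relation.Binary.PropositionalEquality using (_≡_)

Matrix : ℕ → ℕ → Set
Matrix r c = Fin r → Fin c → Bool

-- A (possibly infinite) family of 0-1 matrices, as a predicate.
-- A single matrix P is the family {P}.
Family : Set₁
Family = (r c : ℕ) → Matrix r c → Set

StrictlyIncreasing : ∀ {a b} → (Fin a → Fin b) → Set
StrictlyIncreasing f = ∀ i j → i <ᶠ j → f i <ᶠ f j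

Contains : ∀ {m n r c} → Matrix m n → Matrix r c → Set
Contains {m} {n} {r} {c} M P =
  Σ (Fin r → Fin m) λ f → Σ (Fin c → Fin n) λ g →
    StrictlyIncreasing f × StrictlyIncreasing g ×
    (∀ i j → P i j ≡ true → M (f i) (g j) ≡ true)

Avoids : ∀ {m n r c} → Matrix m n → Matrix r c → Set
Avoids M P = ¬ Contains M P

AvoidsFamily : ∀ {m n} → Matrix m n → Family → Set
AvoidsFamily M 𝒫 = ∀ r c (P : Matrix r c) → 𝒫 r c P → Avoids M P

sumFin : (n : ℕ) → (Fin n → ℕ) → ℕ
sumFin zero    f = 0
sumFin (suc n) f = f fzero + sumFin n (λ i → f (fsuc i))

ones : ∀ {m n} → Matrix m n → ℕ
ones {m} {n} M = sumFin m λ i → sumFin n λ j → if M i j then 1 else 0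

IsMax : (ℕ → Set) → ℕ → Set
IsMax S v = S v × (∀ w → S w → w ≤ v)

-- w ones is achievable by an m-row, n-column 0-1 matrix avoiding 𝒫.
ExAchievable : ℕ → ℕ → Family → ℕ → Set
ExAchievable n m 𝒫 w = Σ (Matrix m n) λ M → AvoidsFamily M 𝒫 × ones M ≡ w

IsEx : ℕ → ℕ → Family → ℕ → Set
IsEx n m 𝒫 = IsMax (ExAchievable n m 𝒫)

-- Lettered matrices: m rows, c columns, entries blank (nothing) or a letter
-- from Fin L.
LMatrix : ℕ → ℕ → ℕ → Set
LMatrix L m c = Fin m → Fin c → Maybe (Fin L)

isLetter : ∀ {L} → Fin L → Maybe (Fin L) → Bool
isLetter a nothing = false
isLetter a (just b) with a ≟ b
... | yes _ = true
... | no  _ = false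

isFilled : ∀ {L} → Maybe (Fin L) → Bool
isFilled nothing  = false
isFilled (just _) = true

occurrences : ∀ {L m c} → LMatrix L m c → Fin L → ℕ
occurrences E a = ones (λ i j → isLetter a (E i j))

support : ∀ {L m c} → LMatrix L m c → Matrix m c
support E i j = isFilled (E i j)

-- L distinct letters (those in Fin L, each occurring at least k ≥ 1 times,
-- hence all present) is achievable.
LxAchievable : ℕ → ℕ → Family → ℕ → Set
LxAchievable k m 𝒫 L =
  ∃ λ c → Σ (LMatrix L m c) λ E →
    (∀ a → k ≤ occurrences E a) ×
    (∀ a → ∃ λ j → ∀ i j' → E i j' ≡ just a → j' ≡ j) ×
    AvoidsFamily (support E) 𝒫

IsLx : ℕ → ℕ → Family → ℕ → Set
IsLx k m 𝒫 = IsMax (LxAchievable k m 𝒫)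

-- Greedy peeling.  As long as some column of M holds at least k ones, pick k
-- of them, make them a new letter and delete them from M.  Every letter then
-- accounts for exactly k ones, and what is left has fewer than k ones per
-- column, i.e. at most k n ones; the letters lie inside M, so their support
-- avoids P as M does, and there are at most lx_k(m, P) of them.
module Submission where

open import Defs
open import Data.Bool using (Bool; true; false; if_then_else_; _∧_; not)
open import Data.Fin using (Fin) renaming (zero to fzero; suc to fsuc)
open import Data.Fin.Properties using (_≟_; any?) renaming (suc-injective to fsuc-injective)
open import Data.Maybe using (Maybe; just; nothing) renaming (map to mapMaybe)
open import Data.Nat using (ℕ; zero; suc; _+_; _*_; _≤_; z≤n; _≤?_)
open import Data.Nat.Properties
  using (+-0-commutativeMonoid; ≤-refl; ≤-trans; ≤-reflexive; ≤-pred; +-mono-≤; +-monoˡ-≤;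
         +-comm; *-comm; +-suc; +-identityʳ; *-suc; *-monoʳ-≤; ≰⇒>; <⇒≤; m+n≤o⇒m≤o; module ≤-Reasoning)
open import Algebra.Properties.CommutativeMonoid.Sum +-0-commutativeMonoid
  using (sum; sum-cong-≗; sum-replicate-zero; ∑-distrib-+; ∑-comm)
open import Data.Product using (∃; _,_)
open import Data.Sum using (_⊎_; inj₁; inj₂)
open import Function using (_∘_)
open import Relation.Nullary using (does; yes; no)
open import Relation.Nullary.Decidable using (dec-true; dec-false)
open import Relation.Binary.PropositionalEquality
  using (_≡_; _≢_; refl; sym; trans; cong; cong₂; module ≡-Reasoning)

private
  variable
    m n L k : ℕ

bit : Bool → ℕ
bit b = if b then 1 else 0

count : (Fin n → Bool) → ℕ
count {n} v = sumFin n (bit ∘ v)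

column : Matrix m n → Fin n → Fin m → Bool
column M j i = M i j

_⊆_ : Matrix m n → Matrix m n → Set
R ⊆ M = ∀ i j → R i j ≡ true → M i j ≡ true

_∖_ : Matrix m n → Matrix m n → Matrix m n
(M ∖ R) i j = M i j ∧ not (R i j)

sumFin≡sum : ∀ n (f : Fin n → ℕ) → sumFin n f ≡ sum f
sumFin≡sum zero    f = refl
sumFin≡sum (suc n) f = cong (f fzero +_) (sumFin≡sum n (f ∘ fsuc))

sumFin-cong : ∀ n {f g : Fin n → ℕ} → (∀ i → f i ≡ g i) → sumFin n f ≡ sumFin n g
sumFin-cong n {f} {g} f≗g = begin
  sumFin n f ≡⟨ sumFin≡sum n f ⟩
  sum f      ≡⟨ sum-cong-≗ f≗g ⟩
  sum g      ≡⟨ sym (sumFin≡sum n g) ⟩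
  sumFin n g ∎
  where open ≡-Reasoning

sumFin-+ : ∀ n (f g : Fin n → ℕ) → sumFin n (λ i → f i + g i) ≡ sumFin n f + sumFin n g
sumFin-+ n f g = begin
  sumFin n (λ i → f i + g i) ≡⟨ sumFin≡sum n _ ⟩
  sum (λ i → f i + g i)      ≡⟨ ∑-distrib-+ f g ⟩
  sum f + sum g              ≡⟨ sym (cong₂ _+_ (sumFin≡sum n f) (sumFin≡sum n g)) ⟩
  sumFin n f + sumFin n g    ∎
  where open ≡-Reasoning

sumFin²≡sum² : ∀ m n (f : Fin m → Fin n → ℕ) →
  sumFin m (λ i → sumFin n (f i)) ≡ sum (λ i → sum (f i))
sumFin²≡sum² m n f = trans (sumFin≡sum m _) (sum-cong-≗ (λ i → sumFin≡sum n (f i)))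

sumFin-comm : ∀ m n (f : Fin m → Fin n → ℕ) →
  sumFin m (λ i → sumFin n (f i)) ≡ sumFin n (λ j → sumFin m (λ i → f i j))
sumFin-comm m n f = begin
  sumFin m (λ i → sumFin n (f i))        ≡⟨ sumFin²≡sum² m n f ⟩
  sum (λ i → sum (f i))                  ≡⟨ ∑-comm f ⟩
  sum (λ j → sum (λ i → f i j))          ≡⟨ sym (sumFin²≡sum² n m (λ j i → f i j)) ⟩
  sumFin n (λ j → sumFin m (λ i → f i j)) ∎
  where open ≡-Reasoning

sumFin-≤ : ∀ n {c} {f : Fin n → ℕ} → (∀ i → f i ≤ c) → sumFin n f ≤ n * c
sumFin-≤ zero    f≤c = z≤n
sumFin-≤ (suc n) f≤c = +-mono-≤ (f≤c fzero) (sumFin-≤ n (f≤c ∘ fsuc))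

sumFin-zero : ∀ n → sumFin n (λ _ → 0) ≡ 0
sumFin-zero n = trans (sumFin≡sum n _) (sum-replicate-zero n)

sumFin-single : ∀ n (j₀ : Fin n) (f : Fin n → ℕ) → (∀ j → j ≢ j₀ → f j ≡ 0) → sumFin n f ≡ f j₀
sumFin-single (suc n) fzero f vanish = begin
  f fzero + sumFin n (f ∘ fsuc)  ≡⟨ cong (f fzero +_) (sumFin-cong n λ j → vanish (fsuc j) λ ()) ⟩
  f fzero + sumFin n (λ _ → 0)   ≡⟨ cong (f fzero +_) (sumFin-zero n) ⟩
  f fzero + 0                    ≡⟨ +-identityʳ (f fzero) ⟩
  f fzero                        ∎
  where open ≡-Reasoning
sumFin-single (suc n) (fsuc j₀) f vanish = trans
  (cong (_+ sumFin n (f ∘ fsuc)) (vanish fzero λ ()))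
  (sumFin-single n j₀ (f ∘ fsuc) λ j j≢j₀ → vanish (fsuc j) (j≢j₀ ∘ fsuc-injective))

ones-columns : (M : Matrix m n) → ones M ≡ sumFin n (count ∘ column M)
ones-columns {m} {n} M = sumFin-comm m n (λ i j → bit (M i j))

ones-cong : {A B : Matrix m n} → (∀ i j → A i j ≡ B i j) → ones A ≡ ones B
ones-cong {m} {n} A≗B = sumFin-cong m λ i → sumFin-cong n λ j → cong bit (A≗B i j)

bit-∖ : ∀ a r → (r ≡ true → a ≡ true) → bit a ≡ bit (a ∧ not r) + bit r
bit-∖ true  false _   = refl
bit-∖ false false _   = refl
bit-∖ _     true  r⇒a rewrite r⇒a refl = refl

ones-∖ : {M R : Matrix m n} → R ⊆ M → ones M ≡ ones (M ∖ R) + ones R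
ones-∖ {m} {n} {M} {R} R⊆M = trans
  (sumFin-cong m λ i → trans
    (sumFin-cong n λ j → bit-∖ (M i j) (R i j) (R⊆M i j))
    (sumFin-+ n _ _))
  (sumFin-+ m _ _)

∖-⊆ : (M R : Matrix m n) → (M ∖ R) ⊆ M
∖-⊆ M R i j with M i j
... | true  = λ _ → refl
... | false = λ ()

∖-disjoint : (M R : Matrix m n) → ∀ i j → (M ∖ R) i j ≡ true → R i j ≡ false
∖-disjoint M R i j with M i j | R i j
... | true  | false = λ _ → refl
... | true  | true  = λ ()
... | false | _     = λ ()

avoids-⊆ : ∀ {A B : Matrix m n} {𝒫} → A ⊆ B → AvoidsFamily B 𝒫 → AvoidsFamily A 𝒫
avoids-⊆ A⊆B avoids r c P P∈𝒫 (f , g , f↑ , g↑ , embed) =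
  avoids r c P P∈𝒫 (f , g , f↑ , g↑ , λ i j → A⊆B (f i) (g j) ∘ embed i j)

takeOnes : ℕ → (Fin m → Bool) → Fin m → Bool
takeOnes zero    v i        = false
takeOnes (suc r) v fzero    = v fzero
takeOnes (suc r) v (fsuc i) = takeOnes (if v fzero then r else suc r) (v ∘ fsuc) i

takeOnes-⊆ : ∀ r (v : Fin m → Bool) i → takeOnes r v i ≡ true → v i ≡ true
takeOnes-⊆ (suc r) v fzero    = λ vi → vi
takeOnes-⊆ (suc r) v (fsuc i) = takeOnes-⊆ (if v fzero then r else suc r) (v ∘ fsuc) i

count-takeOnes : ∀ r (v : Fin m → Bool) → r ≤ count v → count (takeOnes r v) ≡ r
count-takeOnes {m}     zero    v _ = sumFin-zero m
count-takeOnes {suc m} (suc r) v r≤|v| with v fzero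
... | true  = cong suc (count-takeOnes r (v ∘ fsuc) (≤-pred r≤|v|))
... | false = count-takeOnes (suc r) (v ∘ fsuc) r≤|v|

inColumn : Fin n → (Fin m → Bool) → Matrix m n
inColumn j₀ v i j = does (j ≟ j₀) ∧ v i

inColumn-⊆ : ∀ {M : Matrix m n} j₀ {v} → (∀ i → v i ≡ true → M i j₀ ≡ true) → inColumn j₀ v ⊆ M
inColumn-⊆ j₀ v⊆M i j with j ≟ j₀
... | yes refl = v⊆M i
... | no  _    = λ ()

inColumn-column : ∀ (j₀ : Fin n) (v : Fin m → Bool) i j → inColumn j₀ v i j ≡ true → j ≡ j₀
inColumn-column j₀ v i j with j ≟ j₀
... | yes j≡j₀ = λ _ → j≡j₀
... | no  _    = λ ()

ones-inColumn : ∀ (j₀ : Fin n) (v : Fin m → Bool) → ones (inColumn j₀ v) ≡ count v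
ones-inColumn {n} {m} j₀ v = sumFin-cong m λ i → begin
  sumFin n (λ j → bit (does (j ≟ j₀) ∧ v i))  ≡⟨ sumFin-single n j₀ _ (λ j j≢j₀ → cong (λ b → bit (b ∧ v i)) (dec-false (j ≟ j₀) j≢j₀)) ⟩
  bit (does (j₀ ≟ j₀) ∧ v i)                  ≡⟨ cong (λ b → bit (b ∧ v i)) (dec-true (j₀ ≟ j₀) refl) ⟩
  bit (v i)                                ∎
  where open ≡-Reasoning

record ColumnBlock (k : ℕ) (M : Matrix m n) : Set where
  field
    cells   : Matrix m n
    col     : Fin n
    cells⊆M : cells ⊆ M
    inCol   : ∀ i j → cells i j ≡ true → j ≡ col
    size    : ones cells ≡ k

columnBlock : ∀ k (M : Matrix m n) j₀ → k ≤ count (column M j₀) → ColumnBlock k M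
columnBlock k M j₀ k≤|col| = record
  { cells   = inColumn j₀ chosen
  ; col     = j₀
  ; cells⊆M = inColumn-⊆ j₀ (takeOnes-⊆ k (column M j₀))
  ; inCol   = inColumn-column j₀ chosen
  ; size    = trans (ones-inColumn j₀ chosen) (count-takeOnes k (column M j₀) k≤|col|)
  }
  where
  chosen = takeOnes k (column M j₀)

heavyColumn-or-sparse : ∀ k (M : Matrix m n) → (∃ λ j → k ≤ count (column M j)) ⊎ ones M ≤ k * n
heavyColumn-or-sparse {n = n} k M with any? (λ j → k ≤? count (column M j))
... | yes heavy = inj₁ heavy
... | no  ¬heavy = inj₂ (begin
  ones M                            ≡⟨ ones-columns M ⟩
  sumFin n (count ∘ column M)       ≤⟨ sumFin-≤ n (λ j → <⇒≤ (≰⇒> (¬heavy ∘ (j ,_)))) ⟩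
  n * k                             ≡⟨ *-comm n k ⟩
  k * n                             ∎)
  where open ≤-Reasoning

record Lettering (k : ℕ) (M : Matrix m n) : Set where
  field
    letters   : ℕ
    E         : LMatrix letters m n
    support⊆  : support E ⊆ M
    frequent  : ∀ a → k ≤ occurrences E a
    oneColumn : ∀ a → ∃ λ j → ∀ i j′ → E i j′ ≡ just a → j′ ≡ j
    ones≤     : ones M ≤ k * (letters + n)

noLetters : {M : Matrix m n} → ones M ≤ k * n → Lettering k M
noLetters bound = record
  { letters = 0 ; E = λ _ _ → nothing ; support⊆ = λ _ _ ()
  ; frequent = λ () ; oneColumn = λ () ; ones≤ = bound }

withLetter : Bool → Maybe (Fin L) → Maybe (Fin (suc L))
withLetter true  _ = just fzero
withLetter false x = mapMaybe fsuc x

isFilled-withLetter : ∀ b (x : Maybe (Fin L)) →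
  isFilled (withLetter b x) ≡ true → b ≡ true ⊎ isFilled x ≡ true
isFilled-withLetter true  _        _ = inj₁ refl
isFilled-withLetter false (just _) _ = inj₂ refl

isLetter-withLetter-zero : ∀ b (x : Maybe (Fin L)) → isLetter fzero (withLetter b x) ≡ b
isLetter-withLetter-zero true  _        = refl
isLetter-withLetter-zero false nothing  = refl
isLetter-withLetter-zero false (just _) = refl

isLetter-withLetter-suc : ∀ (a : Fin L) b x → (isFilled x ≡ true → b ≡ false) →
  isLetter (fsuc a) (withLetter b x) ≡ isLetter a x
isLetter-withLetter-suc a true  nothing  _         = refl
isLetter-withLetter-suc a true  (just _) filled⇒¬b with filled⇒¬b refl
... | ()
isLetter-withLetter-suc a false nothing  _ = refl
isLetter-withLetter-suc a false (just c) _ with a ≟ c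
... | yes _ = refl
... | no  _ = refl

withLetter≡zero : ∀ b (x : Maybe (Fin L)) → withLetter b x ≡ just fzero → b ≡ true
withLetter≡zero true  _        _ = refl
withLetter≡zero false nothing  ()
withLetter≡zero false (just _) ()

withLetter≡suc : ∀ b (x : Maybe (Fin L)) {a} → withLetter b x ≡ just (fsuc a) → x ≡ just a
withLetter≡suc false (just _) refl = refl

addLetter : {M : Matrix m n} (B : ColumnBlock k M) →
  Lettering k (M ∖ ColumnBlock.cells B) → Lettering k M
addLetter {m} {n} {k} {M} B ℒ = record
  { letters   = suc letters
  ; E         = E′
  ; support⊆  = support⊆′
  ; frequent  = frequent′
  ; oneColumn = oneColumn′
  ; ones≤     = ones≤′
  }
  where
  open ColumnBlock B
  open Lettering ℒ

  E′ : LMatrix (suc letters) m n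
  E′ i j = withLetter (cells i j) (E i j)

  support⊆′ : support E′ ⊆ M
  support⊆′ i j filled with isFilled-withLetter (cells i j) (E i j) filled
  ... | inj₁ inCells = cells⊆M i j inCells
  ... | inj₂ inE     = ∖-⊆ M cells i j (support⊆ i j inE)

  frequent′ : ∀ a → k ≤ occurrences E′ a
  frequent′ fzero    = ≤-reflexive (trans (sym size)
    (ones-cong λ i j → sym (isLetter-withLetter-zero (cells i j) (E i j))))
  frequent′ (fsuc a) = ≤-trans (frequent a) (≤-reflexive
    (ones-cong λ i j → sym (isLetter-withLetter-suc a (cells i j) (E i j)
                              (∖-disjoint M cells i j ∘ support⊆ i j))))

  oneColumn′ : ∀ a → ∃ λ j → ∀ i j′ → E′ i j′ ≡ just a → j′ ≡ j
  oneColumn′ fzero    = col , λ i j′ → inCol i j′ ∘ withLetter≡zero (cells i j′) (E i j′)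
  oneColumn′ (fsuc a) =
    let j , E⇒j = oneColumn a in j , λ i j′ → E⇒j i j′ ∘ withLetter≡suc (cells i j′) (E i j′)

  ones≤′ : ones M ≤ k * (suc letters + n)
  ones≤′ = begin
    ones M                        ≡⟨ ones-∖ cells⊆M ⟩
    ones (M ∖ cells) + ones cells ≡⟨ cong (ones (M ∖ cells) +_) size ⟩
    ones (M ∖ cells) + k          ≤⟨ +-monoˡ-≤ k ones≤ ⟩
    k * (letters + n) + k         ≡⟨ +-comm (k * (letters + n)) k ⟩
    k + k * (letters + n)         ≡⟨ *-suc k (letters + n) ⟨
    k * (suc letters + n)         ∎
    where open ≤-Reasoning

lettering : ∀ k t (M : Matrix m n) → ones M ≤ t → Lettering (suc k) M
lettering k zero    M ones≤0 = noLetters (≤-trans ones≤0 z≤n)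
lettering k (suc t) M ones≤1+t with heavyColumn-or-sparse (suc k) M
... | inj₂ sparse         = noLetters sparse
... | inj₁ (j₀ , heavy)   = addLetter B (lettering k t (M ∖ cells) rest≤t)
  where
  B = columnBlock (suc k) M j₀ heavy
  open ColumnBlock B

  rest≤t : ones (M ∖ cells) ≤ t
  rest≤t = m+n≤o⇒m≤o (ones (M ∖ cells)) (≤-pred (begin
    suc (ones (M ∖ cells) + k)    ≡⟨ +-suc (ones (M ∖ cells)) k ⟨
    ones (M ∖ cells) + suc k      ≡⟨ cong (ones (M ∖ cells) +_) size ⟨
    ones (M ∖ cells) + ones cells ≡⟨ ones-∖ cells⊆M ⟨
    ones M                        ≤⟨ ones≤1+t ⟩
    suc t                         ∎))
    where open ≤-Reasoning

lemma1 : (𝒫 : Family) (n m k : ℕ) → 1 ≤ n → 1 ≤ m → 1 ≤ k →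
    (e l : ℕ) → IsEx n m 𝒫 e → IsLx k m 𝒫 l → e ≤ k * (l + n)
lemma1 𝒫 n m (suc k) _ _ _ e l ((M , M-avoids , refl) , _) (_ , lx-maximal) =
  ≤-trans ones≤ (*-monoʳ-≤ (suc k) (+-monoˡ-≤ n letters≤l))
  where
  open Lettering (lettering k (ones M) M ≤-refl)

  letters≤l : letters ≤ l
  letters≤l = lx-maximal letters (n , E , frequent , oneColumn , avoids-⊆ support⊆ M-avoids)
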